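{- Let $d_M,\dots,d_0$ be an $a$-valid sequence. For $n\ge0$, let $b_n$ be the positive integer whose $a$-Zeckendorf representation is $d_M,\dots,d_0$ followed by $n$ zeroes. Then $(b_n)_{n\ge0}$ satisfies the recurrence $a$, i.e. $b_n=\sum_{i=1}^k\lambda_ib_{n-i}$ for all $n\ge k$, with initial conditions $b_0,b_1,\dots,b_{k-1}$.
   Context: Fix nonnegative integers $\lambda_1,\lambda_2,\dots$ and an integer $k\ge1$ (the order) such that $\lambda_1\ge1$, $\lambda_k\ge1$, $\lambda_i=0$ for $i>k$, and $\lambda_1\ge2$ if $k=1$; the recurrence $a$ is $a_n=\sum_{i=1}^k\lambda_ia_{n-i}$. Let $\Lambda_j=\sum_{i=1}^j\lambda_i$, $\Lambda=\Lambda_k$, and for $0\le\ell<\Lambda$ let $\mu_\ell$ be the least $j$ with $\Lambda_j>\ell$. A digit sequence $d_M,\dots,d_0$ is $a$-valid if $0\le d_i<\Lambda$ for all $i$, $d_M\ne0$, and whenever $d_i=\ell$ with $i<M$ we have $d_{i+1}=\dots=d_{i+\mu_\ell-1}=0$. Order the $a$-valid sequences with shorter first and equal lengths lexicographically (comparing $d_M$ first); the $a$-Zeckendorf representation of a positive integer $N$ is the $N$-th sequence in this order. -}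

module Defs where

open import Data.Nat using (ℕ; zero; suc; _+_; _*_; _∸_; _<ᵇ_; _≡ᵇ_)
open import Data.Bool using (Bool; T?; true; false; _∧_; _∨_; not; if_then_else_)
open import Data.List using (List; []; _∷_; length; reverse; filter; concatMap; map; allFin; upTo; all; and; applyUpTo)
open import Data.List using (lookup)
open import Data.Fin using (Fin; toℕ)
open import Relation.Binary.PropositionalEquality using (_≡_)
open import Data.Product using (_×_)

-- The recurrence coefficients are a function  lam : ℕ → ℕ , where  lam i  is
-- λ_i for i ≥ 1 (lam 0 is irrelevant).

sum1 : ℕ → (ℕ → ℕ) → ℕ
sum1 zero    f = 0
sum1 (suc j) f = sum1 j f + f (suc j)

Lam : (ℕ → ℕ) → ℕ → ℕ
Lam lam j = sum1 j lam

LamTot : (ℕ → ℕ) → ℕ → ℕ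
LamTot lam k = Lam lam k

-- μ_ℓ : least j ≥ 1 with Λ_j > ℓ (search over j = 1,…,k; for ℓ < Λ it is found).
muSearch : (ℕ → ℕ) → ℕ → ℕ → ℕ → ℕ
muSearch lam ℓ zero      j = j
muSearch lam ℓ (suc fuel) j = if ℓ <ᵇ Lam lam j then j else muSearch lam ℓ fuel (suc j)

mu : (ℕ → ℕ) → ℕ → ℕ → ℕ
mu lam k ℓ = muSearch lam ℓ k 1

-- A digit sequence d_M,…,d_0 is a list, most significant digit first.
-- digit ds i = d_i  (and 0 for i > M).
digitAt : List ℕ → ℕ → ℕ
digitAt []       i       = 0
digitAt (x ∷ xs) zero    = x
digitAt (x ∷ xs) (suc i) = digitAt xs i

digit : List ℕ → ℕ → ℕ
digit ds i = digitAt (reverse ds) i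

allBelow : ℕ → (ℕ → Bool) → Bool
allBelow zero    p = true
allBelow (suc n) p = allBelow n p ∧ p n

-- a-valid: nonempty, all digits < Λ, d_M ≠ 0, and for every i < M with d_i = ℓ,
-- d_{i+1} = … = d_{i+μ_ℓ-1} = 0  (here d_j for j > M reads as 0, which is harmless
-- since the run of indices i+1,…,i+μ_ℓ-1 would then contain M and d_M ≠ 0).
valid : (ℕ → ℕ) → ℕ → List ℕ → Bool
valid lam k []         = false
valid lam k ds@(dM ∷ _) =
  not (dM ≡ᵇ 0)
  ∧ allBelow (length ds) (λ i → digit ds i <ᵇ LamTot lam k)
  ∧ allBelow (length ds ∸ 1) (λ i →
       allBelow (mu lam k (digit ds i) ∸ 1) (λ j → digit ds (i + suc j) ≡ᵇ 0))

lexLess : List ℕ → List ℕ → Bool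
lexLess []       _        = false
lexLess (_ ∷ _)  []       = false
lexLess (x ∷ xs) (y ∷ ys) = (x <ᵇ y) ∨ ((x ≡ᵇ y) ∧ lexLess xs ys)

seqLess : List ℕ → List ℕ → Bool
seqLess t s = (length t <ᵇ length s) ∨ ((length t ≡ᵇ length s) ∧ lexLess t s)

allLists : ℕ → ℕ → List (List ℕ)
allLists b zero    = [] ∷ []
allLists b (suc L) = concatMap (λ x → map (x ∷_) (allLists b L)) (upTo b)

allListsUpTo : ℕ → ℕ → List (List ℕ)
allListsUpTo b zero    = []
allListsUpTo b (suc n) = allListsUpTo b n Data.List.++ allLists b (suc n)

-- number of a-valid sequences strictly preceding s in the order
-- (every such sequence has length ≤ length s and digits < Λ, so they are all enumerated)
countBefore : (ℕ → ℕ) → ℕ → List ℕ → ℕ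
countBefore lam k s =
  length (filter (λ t → T? (valid lam k t ∧ seqLess t s))
                 (allListsUpTo (LamTot lam k) (length s)))

-- ds is the a-Zeckendorf representation of N, i.e. ds is the N-th a-valid
-- sequence in the order (exactly N-1 a-valid sequences precede it).
IsZeck : (ℕ → ℕ) → ℕ → ℕ → List ℕ → Set
IsZeck lam k N ds = (valid lam k ds ≡ true) × (N ≡ suc (countBefore lam k ds))

-- A valid digit sequence t ends in a block: its last digit ℓ preceded by μ_ℓ − 1 zeros. Exactly
-- λ_j digits ℓ have μ_ℓ = j (namely Λ_{j−1} ≤ ℓ < Λ_j), and if the final block of t has length j,
-- then t is valid and precedes ds 0ⁿ exactly when t with this block removed is valid and precedes
-- ds 0ⁿ⁻ʲ. Since the leading digit is nonzero, a block is never a whole sequence of length ≥ 2, so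
-- apart from the Λ − 1 one-digit sequences every predecessor of ds 0ⁿ arises in this way. With
-- b_n = 1 + #predecessors this gives b_n = Λ + Σ_j λ_j (b_{n−j} − 1) = Σ_j λ_j b_{n−j}.
module Submission where

open import Defs
open import Data.Nat using (ℕ; _≤_; _<_; _*_; _∸_)
open import Data.List using (List; _++_; replicate)
open import Data.Bool using (true)
open import Data.Product using (_×_; ∃)
open import Relation.Binary.PropositionalEquality using (_≡_)

open import Data.Bool using (Bool; false; _∧_; not; T?)
open import Data.Bool.Properties using (∧-zeroʳ; ∧-identityʳ; ∧-assoc; ∧-comm; T-≡)
open import Data.Empty using (⊥-elim)
open import Data.List using ([]; _∷_; map; concatMap; filter; length; upTo; reverse)
open import Data.List.Properties using (applyUpTo-∷ʳ; map-cong; length-++; length-replicate; length-reverse; reverse-++; unfold-reverse; ++-assoc)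
open import Data.List.Relation.Unary.All as All using (All; []; _∷_)
open import Data.List.Relation.Unary.All.Properties using (concat⁺; map⁺)
open import Data.Nat using (zero; suc; _+_; _⊓_; _<ᵇ_; _≡ᵇ_; z≤n; s≤s; _<?_)
open import Data.Nat.ListAction using (sum)
open import Data.Nat.Properties
open import Algebra.Properties.CommutativeSemigroup +-commutativeSemigroup using () renaming (interchange to +-interchange)
open import Data.Product using (_,_; proj₁; proj₂)
open import Data.Sum using (_⊎_; inj₁; inj₂; map₂)
open import Function using (_∘_; Equivalence)
open import Relation.Binary.Definitions using (tri<; tri≈; tri>)
open import Relation.Binary.PropositionalEquality using (_≢_; refl; sym; trans; cong; cong₂; subst; subst₂; module ≡-Reasoning)
open import Relation.Nullary using (yes; no)

open ≡-Reasoning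

private
  variable
    A B : Set

false≢true : false ≢ true
false≢true ()

<ᵇ-true : ∀ {m n} → m < n → (m <ᵇ n) ≡ true
<ᵇ-true m<n = Equivalence.to T-≡ (<⇒<ᵇ m<n)

<ᵇ-true⁻¹ : ∀ {m n} → (m <ᵇ n) ≡ true → m < n
<ᵇ-true⁻¹ {m} {n} eq = <ᵇ⇒< m n (Equivalence.from T-≡ eq)

<ᵇ-false : ∀ {m n} → n ≤ m → (m <ᵇ n) ≡ false
<ᵇ-false {m} {n} n≤m with m <ᵇ n in eq
... | false = refl
... | true  = ⊥-elim (<⇒≱ (<ᵇ-true⁻¹ eq) n≤m)

<ᵇ-false⁻¹ : ∀ {m n} → (m <ᵇ n) ≡ false → n ≤ m
<ᵇ-false⁻¹ eq = ≮⇒≥ (λ m<n → false≢true (trans (sym eq) (<ᵇ-true m<n)))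

≡ᵇ-true⁻¹ : ∀ {m n} → (m ≡ᵇ n) ≡ true → m ≡ n
≡ᵇ-true⁻¹ {m} {n} eq = ≡ᵇ⇒≡ m n (Equivalence.from T-≡ eq)

≡ᵇ-refl : ∀ n → (n ≡ᵇ n) ≡ true
≡ᵇ-refl n = Equivalence.to T-≡ (≡⇒≡ᵇ n n refl)

≡ᵇ-false : ∀ {m n} → m ≢ n → (m ≡ᵇ n) ≡ false
≡ᵇ-false {m} {n} m≢n with m ≡ᵇ n in eq
... | false = refl
... | true  = ⊥-elim (m≢n (≡ᵇ-true⁻¹ eq))

∧-true⁻¹ : ∀ a b → a ∧ b ≡ true → a ≡ true × b ≡ true
∧-true⁻¹ true b b≡true = refl , b≡true

-- Counting

indicator : Bool → ℕ
indicator true  = 1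
indicator false = 0

count : (A → Bool) → List A → ℕ
count p []       = 0
count p (x ∷ xs) = indicator (p x) + count p xs

length-filter≡count : ∀ (p : A → Bool) xs → length (filter (T? ∘ p) xs) ≡ count p xs
length-filter≡count p []       = refl
length-filter≡count p (x ∷ xs) with p x
... | true  = cong suc (length-filter≡count p xs)
... | false = length-filter≡count p xs

count-cong : ∀ {p q : A → Bool} {xs} → All (λ x → p x ≡ q x) xs → count p xs ≡ count q xs
count-cong []         = refl
count-cong (eq ∷ eqs) = cong₂ _+_ (cong indicator eq) (count-cong eqs)

count-++ : ∀ (p : A → Bool) xs ys → count p (xs ++ ys) ≡ count p xs + count p ys
count-++ p []       ys = refl
count-++ p (x ∷ xs) ys = trans (cong (indicator (p x) +_) (count-++ p xs ys)) (sym (+-assoc (indicator (p x)) _ _))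

count-false : ∀ xs → count (λ (_ : A) → false) xs ≡ 0
count-false []       = refl
count-false (x ∷ xs) = count-false xs

count-const-∧ : ∀ b (p : A → Bool) xs → count (λ x → b ∧ p x) xs ≡ indicator b * count p xs
count-const-∧ true  p xs = sym (+-identityʳ (count p xs))
count-const-∧ false p xs = count-false xs

count-+ : ∀ {p q r : A → Bool} → (∀ x → indicator (p x) + indicator (q x) ≡ indicator (r x)) →
          ∀ xs → count p xs + count q xs ≡ count r xs
count-+ e []       = refl
count-+ {p = p} {q = q} e (x ∷ xs) =
  trans (+-interchange (indicator (p x)) (count p xs) (indicator (q x)) (count q xs))
        (cong₂ _+_ (e x) (count-+ e xs))

count-map : ∀ (p : B → Bool) (f : A → B) xs → count p (map f xs) ≡ count (p ∘ f) xs
count-map p f []       = refl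
count-map p f (x ∷ xs) = cong (indicator (p (f x)) +_) (count-map p f xs)

count-concatMap : ∀ (p : B → Bool) (f : A → List B) xs →
                  count p (concatMap f xs) ≡ sum (map (count p ∘ f) xs)
count-concatMap p f []       = refl
count-concatMap p f (x ∷ xs) =
  trans (count-++ p (f x) (concatMap f xs)) (cong (count p (f x) +_) (count-concatMap p f xs))

sum-map-*ʳ : ∀ (f : A → ℕ) c xs → sum (map (λ x → f x * c) xs) ≡ sum (map f xs) * c
sum-map-*ʳ f c []       = refl
sum-map-*ʳ f c (x ∷ xs) = trans (cong (f x * c +_) (sum-map-*ʳ f c xs)) (sym (*-distribʳ-+ c (f x) (sum (map f xs))))

count-<ᵇ-upTo : ∀ {c n} → c ≤ n → count (_<ᵇ c) (upTo n) ≡ c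
count-<ᵇ-upTo {c} {n} c≤n = trans (count-<ᵇ-upTo-⊓ c n) (m≤n⇒m⊓n≡m c≤n)
  where
  ⊓-suc-indicator : ∀ c n → c ⊓ n + indicator (n <ᵇ c) ≡ c ⊓ suc n
  ⊓-suc-indicator zero    n       = refl
  ⊓-suc-indicator (suc c) zero    = cong suc (sym (⊓-zeroʳ c))
  ⊓-suc-indicator (suc c) (suc n) = cong suc (⊓-suc-indicator c n)
  count-<ᵇ-upTo-⊓ : ∀ c n → count (_<ᵇ c) (upTo n) ≡ c ⊓ n
  count-<ᵇ-upTo-⊓ c zero    = sym (⊓-zeroʳ c)
  count-<ᵇ-upTo-⊓ c (suc n) = begin
      count (_<ᵇ c) (upTo (suc n))
    ≡⟨ cong (count (_<ᵇ c)) (sym (applyUpTo-∷ʳ (λ x → x) n)) ⟩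
      count (_<ᵇ c) (upTo n ++ n ∷ [])
    ≡⟨ count-++ (_<ᵇ c) (upTo n) (n ∷ []) ⟩
      count (_<ᵇ c) (upTo n) + (indicator (n <ᵇ c) + 0)
    ≡⟨ cong₂ _+_ (count-<ᵇ-upTo-⊓ c n) (+-identityʳ (indicator (n <ᵇ c))) ⟩
      c ⊓ n + indicator (n <ᵇ c)
    ≡⟨ ⊓-suc-indicator c n ⟩
      c ⊓ suc n ∎

count-interval-upTo : ∀ {a c n} → a ≤ c → c ≤ n → count (λ x → (x <ᵇ c) ∧ not (x <ᵇ a)) (upTo n) ≡ c ∸ a
count-interval-upTo {a} {c} {n} a≤c c≤n = begin
    count inInterval (upTo n)
  ≡⟨ sym (m+n∸n≡m _ a) ⟩
    count inInterval (upTo n) + a ∸ a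
  ≡⟨ cong (λ z → count inInterval (upTo n) + z ∸ a) (sym (count-<ᵇ-upTo (≤-trans a≤c c≤n))) ⟩
    count inInterval (upTo n) + count (_<ᵇ a) (upTo n) ∸ a
  ≡⟨ cong (_∸ a) (trans (count-+ split (upTo n)) (count-<ᵇ-upTo c≤n)) ⟩
    c ∸ a ∎
  where
  inInterval : ℕ → Bool
  inInterval x = (x <ᵇ c) ∧ not (x <ᵇ a)
  split : ∀ x → indicator (inInterval x) + indicator (x <ᵇ a) ≡ indicator (x <ᵇ c)
  split x with x <ᵇ a in x<a
  ... | false = trans (+-identityʳ _) (cong indicator (∧-identityʳ _))
  ... | true  rewrite <ᵇ-true (<-≤-trans (<ᵇ-true⁻¹ x<a) a≤c) = refl

sum1-zeros : ∀ n → sum1 n (λ _ → 0) ≡ 0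
sum1-zeros zero    = refl
sum1-zeros (suc n) = cong (_+ 0) (sum1-zeros n)

sum1-cong : ∀ n {f g : ℕ → ℕ} → (∀ i → 1 ≤ i → i ≤ n → f i ≡ g i) → sum1 n f ≡ sum1 n g
sum1-cong zero    eq = refl
sum1-cong (suc n) eq = cong₂ _+_ (sum1-cong n (λ i 1≤i i≤n → eq i 1≤i (m≤n⇒m≤1+n i≤n))) (eq (suc n) (s≤s z≤n) ≤-refl)

sum1-+ : ∀ n (f g : ℕ → ℕ) → sum1 n (λ i → f i + g i) ≡ sum1 n f + sum1 n g
sum1-+ zero    f g = refl
sum1-+ (suc n) f g = trans (cong (_+ (f (suc n) + g (suc n))) (sum1-+ n f g))
                           (+-interchange (sum1 n f) (sum1 n g) (f (suc n)) (g (suc n)))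

sum1-*ˡ : ∀ n c (f : ℕ → ℕ) → sum1 n (λ i → c * f i) ≡ c * sum1 n f
sum1-*ˡ zero    c f = sym (*-zeroʳ c)
sum1-*ˡ (suc n) c f = trans (cong (_+ c * f (suc n)) (sum1-*ˡ n c f)) (sym (*-distribˡ-+ c (sum1 n f) (f (suc n))))

sum1-comm : ∀ n m (F : ℕ → ℕ → ℕ) → sum1 n (λ i → sum1 m (F i)) ≡ sum1 m (λ j → sum1 n (λ i → F i j))
sum1-comm zero    m F = sym (sum1-zeros m)
sum1-comm (suc n) m F = trans (cong (_+ sum1 m (F (suc n))) (sum1-comm n m F))
                              (sym (sum1-+ m (λ j → sum1 n (λ i → F i j)) (F (suc n))))

sum1-+-split : ∀ a b (f : ℕ → ℕ) → sum1 (a + b) f ≡ sum1 a f + sum1 b (λ i → f (a + i))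
sum1-+-split a zero    f = trans (cong (λ n → sum1 n f) (+-identityʳ a)) (sym (+-identityʳ _))
sum1-+-split a (suc b) f = begin
    sum1 (a + suc b) f
  ≡⟨ cong (λ n → sum1 n f) (+-suc a b) ⟩
    sum1 (a + b) f + f (suc (a + b))
  ≡⟨ cong₂ _+_ (sum1-+-split a b f) (cong f (sym (+-suc a b))) ⟩
    (sum1 a f + sum1 b (λ i → f (a + i))) + f (a + suc b)
  ≡⟨ +-assoc (sum1 a f) _ _ ⟩
    sum1 a f + sum1 (suc b) (λ i → f (a + i)) ∎

sum1-first : ∀ n (f : ℕ → ℕ) → 1 ≤ n → (∀ i → 2 ≤ i → i ≤ n → f i ≡ 0) → sum1 n f ≡ f 1
sum1-first (suc n) f _ vanish = begin
    sum1 (1 + n) f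
  ≡⟨ sum1-+-split 1 n f ⟩
    f 1 + sum1 n (f ∘ suc)
  ≡⟨ cong (f 1 +_) (trans (sum1-cong n (λ i 1≤i i≤n → vanish (suc i) (s≤s 1≤i) (s≤s i≤n))) (sum1-zeros n)) ⟩
    f 1 + 0
  ≡⟨ +-identityʳ (f 1) ⟩
    f 1 ∎

sum1-indicator-≡ᵇ : ∀ n {v} → 1 ≤ v → v ≤ n → sum1 n (λ j → indicator (v ≡ᵇ j)) ≡ 1
sum1-indicator-≡ᵇ zero    (s≤s _) ()
sum1-indicator-≡ᵇ (suc n) {v} 1≤v v≤1+n with v ≟ suc n
... | yes refl = cong₂ _+_
  (trans (sum1-cong n (λ j _ j≤n → cong indicator (≡ᵇ-false (>⇒≢ (s≤s j≤n))))) (sum1-zeros n))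
  (cong indicator (≡ᵇ-refl v))
... | no v≢1+n = cong₂ _+_ (sum1-indicator-≡ᵇ n 1≤v (≤-pred (≤∧≢⇒< v≤1+n v≢1+n))) (cong indicator (≡ᵇ-false v≢1+n))

count-sum1 : ∀ n {p : A → Bool} {q : ℕ → A → Bool} →
             (∀ x → indicator (p x) ≡ sum1 n (λ j → indicator (q j x))) →
             ∀ xs → count p xs ≡ sum1 n (λ j → count (q j) xs)
count-sum1 n split []       = sym (sum1-zeros n)
count-sum1 n {q = q} split (x ∷ xs) =
  trans (cong₂ _+_ (split x) (count-sum1 n split xs)) (sym (sum1-+ n (λ j → indicator (q j x)) (λ j → count (q j) xs)))

-- Enumerations of digit lists

allLists-length : ∀ b m → All (λ t → length t ≡ m) (allLists b m)
allLists-length b zero    = refl ∷ []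
allLists-length b (suc m) =
  concat⁺ (map⁺ (All.universal (λ x → map⁺ (All.map (cong suc) (allLists-length b m))) (upTo b)))

count-allLists-suc : ∀ b m (p : List ℕ → Bool) →
  count p (allLists b (suc m)) ≡ sum (map (λ x → count (p ∘ (x ∷_)) (allLists b m)) (upTo b))
count-allLists-suc b m p = trans (count-concatMap p (λ x → map (x ∷_) (allLists b m)) (upTo b))
  (cong sum (map-cong (λ x → count-map p (x ∷_) (allLists b m)) (upTo b)))

count-allLists-one : ∀ b (p : List ℕ → Bool) → count p (allLists b 1) ≡ count (λ x → p (x ∷ [])) (upTo b)
count-allLists-one b p = go (upTo b)
  where
  go : ∀ xs → count p (concatMap (λ x → (x ∷ []) ∷ []) xs) ≡ count (λ x → p (x ∷ [])) xs
  go []       = refl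
  go (x ∷ xs) = cong (indicator (p (x ∷ [])) +_) (go xs)

count-allLists-++ : ∀ b a c {f p q : List ℕ → Bool} →
  (∀ t u → length t ≡ a → length u ≡ c → f (t ++ u) ≡ p t ∧ q u) →
  count f (allLists b (a + c)) ≡ count p (allLists b a) * count q (allLists b c)
count-allLists-++ b zero c {f} {p} {q} split = begin
    count f (allLists b c)
  ≡⟨ count-cong (All.map (λ {u} lu → split [] u refl lu) (allLists-length b c)) ⟩
    count (λ u → p [] ∧ q u) (allLists b c)
  ≡⟨ count-const-∧ (p []) q (allLists b c) ⟩
    indicator (p []) * count q (allLists b c)
  ≡⟨ cong (_* count q (allLists b c)) (sym (+-identityʳ (indicator (p [])))) ⟩
    count p ([] ∷ []) * count q (allLists b c) ∎
count-allLists-++ b (suc a) c {f} {p} {q} split = begin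
    count f (allLists b (suc (a + c)))
  ≡⟨ count-allLists-suc b (a + c) f ⟩
    sum (map (λ x → count (f ∘ (x ∷_)) (allLists b (a + c))) (upTo b))
  ≡⟨ cong sum (map-cong (λ x → count-allLists-++ b a c (λ t u lt lu → split (x ∷ t) u (cong suc lt) lu)) (upTo b)) ⟩
    sum (map (λ x → count (p ∘ (x ∷_)) (allLists b a) * Q) (upTo b))
  ≡⟨ sum-map-*ʳ (λ x → count (p ∘ (x ∷_)) (allLists b a)) Q (upTo b) ⟩
    sum (map (λ x → count (p ∘ (x ∷_)) (allLists b a)) (upTo b)) * Q
  ≡⟨ cong (_* Q) (sym (count-allLists-suc b a p)) ⟩
    count p (allLists b (suc a)) * Q ∎
  where
  Q : ℕ
  Q = count q (allLists b c)

count-allListsUpTo : ∀ b L (p : List ℕ → Bool) → count p (allListsUpTo b L) ≡ sum1 L (λ m → count p (allLists b m))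
count-allListsUpTo b zero    p = refl
count-allListsUpTo b (suc L) p = trans (count-++ p (allListsUpTo b L) (allLists b (suc L)))
                                       (cong (_+ count p (allLists b (suc L))) (count-allListsUpTo b L p))

allZero : List ℕ → Bool
allZero []       = true
allZero (x ∷ xs) = (x ≡ᵇ 0) ∧ allZero xs

count-allZero-allLists : ∀ {b} → 1 ≤ b → ∀ m → count allZero (allLists b m) ≡ 1
count-allZero-allLists 1≤b zero    = refl
count-allZero-allLists {b} 1≤b (suc m) = begin
    count allZero (allLists b (1 + m))
  ≡⟨ count-allLists-++ b 1 m (λ { (x ∷ []) u _ _ → cong (_∧ allZero u) (sym (∧-identityʳ (x ≡ᵇ 0))) }) ⟩
    count allZero (allLists b 1) * count allZero (allLists b m)
  ≡⟨ cong₂ _*_ (trans (count-allLists-one b allZero) (trans (count-cong (All.universal isZero (upTo b))) (count-<ᵇ-upTo 1≤b)))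
               (count-allZero-allLists 1≤b m) ⟩
    1 ∎
  where
  isZero : ∀ x → ((x ≡ᵇ 0) ∧ true) ≡ (x <ᵇ 1)
  isZero zero    = refl
  isZero (suc x) = refl

reverse-replicate : ∀ n (x : A) → reverse (replicate n x) ≡ replicate n x
reverse-replicate zero    x = refl
reverse-replicate (suc n) x = begin
    reverse (x ∷ replicate n x)       ≡⟨ unfold-reverse x (replicate n x) ⟩
    reverse (replicate n x) ++ x ∷ [] ≡⟨ cong (_++ x ∷ []) (reverse-replicate n x) ⟩
    replicate n x ++ x ∷ []           ≡⟨ replicate-snoc n ⟩
    x ∷ replicate n x                 ∎
  where
  replicate-snoc : ∀ n → replicate n x ++ x ∷ [] ≡ x ∷ replicate n x
  replicate-snoc zero    = refl
  replicate-snoc (suc n) = cong (x ∷_) (replicate-snoc n)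

replicate-+ : ∀ a b (x : A) → replicate (a + b) x ≡ replicate a x ++ replicate b x
replicate-+ zero    b x = refl
replicate-+ (suc a) b x = cong (x ∷_) (replicate-+ a b x)

allBelow-suc : ∀ n (p : ℕ → Bool) → allBelow (suc n) p ≡ p 0 ∧ allBelow n (λ i → p (suc i))
allBelow-suc zero    p = sym (∧-identityʳ (p 0))
allBelow-suc (suc n) p = trans (cong (_∧ p (suc n)) (allBelow-suc n p)) (∧-assoc (p 0) _ _)

allBelow-true : ∀ {n} {p : ℕ → Bool} → allBelow n p ≡ true → ∀ i → i < n → p i ≡ true
allBelow-true {suc n} {p} all-p i i<1+n with ∧-true⁻¹ (allBelow n p) (p n) all-p | m≤n⇒m<n∨m≡n (≤-pred i<1+n)
... | below-p , _   | inj₁ i<n  = allBelow-true below-p i i<n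
... | _       , p-n | inj₂ refl = p-n

digitAt-++ : ∀ xs ys i → digitAt (xs ++ ys) (length xs + i) ≡ digitAt ys i
digitAt-++ []       ys i = refl
digitAt-++ (x ∷ xs) ys i = digitAt-++ xs ys i

digit-last : ∀ d ds → digit (d ∷ ds) (length ds) ≡ d
digit-last d ds = begin
    digitAt (reverse (d ∷ ds)) (length ds)
  ≡⟨ cong₂ digitAt (unfold-reverse d ds) (sym (trans (+-identityʳ _) (length-reverse ds))) ⟩
    digitAt (reverse ds ++ d ∷ []) (length (reverse ds) + 0)
  ≡⟨ digitAt-++ (reverse ds) (d ∷ []) 0 ⟩
    d ∎

allZero-prefix : ∀ w r → allBelow (length w) (λ i → digitAt (w ++ r) i ≡ᵇ 0) ≡ allZero w
allZero-prefix []      r = refl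
allZero-prefix (x ∷ w) r = trans (allBelow-suc (length w) (λ i → digitAt (x ∷ w ++ r) i ≡ᵇ 0)) (cong ((x ≡ᵇ 0) ∧_) (allZero-prefix w r))

allZero⇒replicate : ∀ w → allZero w ≡ true → w ≡ replicate (length w) 0
allZero⇒replicate []      _ = refl
allZero⇒replicate (x ∷ w) zeros with x ≡ᵇ 0 in x≡0 | allZero w in w≡0
... | true | true = cong₂ _∷_ (≡ᵇ-true⁻¹ x≡0) (allZero⇒replicate w w≡0)

allZero-reverse : ∀ w → allZero (reverse w) ≡ allZero w
allZero-reverse []      = refl
allZero-reverse (x ∷ w) = begin
    allZero (reverse (x ∷ w))               ≡⟨ cong allZero (unfold-reverse x w) ⟩
    allZero (reverse w ++ x ∷ [])           ≡⟨ allZero-++ (reverse w) (x ∷ []) ⟩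
    allZero (reverse w) ∧ ((x ≡ᵇ 0) ∧ true) ≡⟨ cong₂ _∧_ (allZero-reverse w) (∧-identityʳ (x ≡ᵇ 0)) ⟩
    allZero w ∧ (x ≡ᵇ 0)                    ≡⟨ ∧-comm (allZero w) (x ≡ᵇ 0) ⟩
    allZero (x ∷ w)                         ∎
  where
  allZero-++ : ∀ xs ys → allZero (xs ++ ys) ≡ allZero xs ∧ allZero ys
  allZero-++ []       ys = refl
  allZero-++ (x ∷ xs) ys = trans (cong ((x ≡ᵇ 0) ∧_) (allZero-++ xs ys)) (sym (∧-assoc (x ≡ᵇ 0) (allZero xs) (allZero ys)))

-- The numeration system

Lam-mono : ∀ lam {i j} → i ≤ j → Lam lam i ≤ Lam lam j
Lam-mono lam {j = zero}  z≤n   = ≤-refl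
Lam-mono lam {i} {suc j} i≤1+j with m≤n⇒m<n∨m≡n i≤1+j
... | inj₁ i<1+j = ≤-trans (Lam-mono lam (≤-pred i<1+j)) (m≤m+n (Lam lam j) (lam (suc j)))
... | inj₂ refl  = ≤-refl

muSearch-spec : ∀ lam ℓ fuel j₀ →
  j₀ ≤ muSearch lam ℓ fuel j₀ ×
  (∀ j → j₀ ≤ j → j < muSearch lam ℓ fuel j₀ → Lam lam j ≤ ℓ) ×
  (ℓ < Lam lam (muSearch lam ℓ fuel j₀) ⊎ muSearch lam ℓ fuel j₀ ≡ j₀ + fuel)
muSearch-spec lam ℓ zero j₀ = ≤-refl , (λ j j₀≤j j<j₀ → ⊥-elim (<⇒≱ j<j₀ j₀≤j)) , inj₂ (sym (+-identityʳ j₀))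
muSearch-spec lam ℓ (suc fuel) j₀ with ℓ <ᵇ Lam lam j₀ in ℓ<Λj₀
... | true  = ≤-refl , (λ j j₀≤j j<j₀ → ⊥-elim (<⇒≱ j<j₀ j₀≤j)) , inj₁ (<ᵇ-true⁻¹ ℓ<Λj₀)
... | false with muSearch-spec lam ℓ fuel (suc j₀)
...   | j₀<r , below , found = <⇒≤ j₀<r , below′ , map₂ (λ r≡ → trans r≡ (sym (+-suc j₀ fuel))) found
  where
  below′ : ∀ j → j₀ ≤ j → j < muSearch lam ℓ fuel (suc j₀) → Lam lam j ≤ ℓ
  below′ j j₀≤j j<r with m≤n⇒m<n∨m≡n j₀≤j
  ... | inj₁ j₀<j = below j j₀<j j<r
  ... | inj₂ refl = <ᵇ-false⁻¹ ℓ<Λj₀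

module Numeration (lam : ℕ → ℕ) (k : ℕ) (1≤k : 1 ≤ k) (1≤λ₁ : 1 ≤ lam 1) where

  Λ : ℕ
  Λ = LamTot lam k

  μ : ℕ → ℕ
  μ = mu lam k

  1≤Λ : 1 ≤ Λ
  1≤Λ = ≤-trans 1≤λ₁ (Lam-mono lam 1≤k)

  μ-positive : ∀ ℓ → 1 ≤ μ ℓ
  μ-positive ℓ = proj₁ (muSearch-spec lam ℓ k 1)

  μ-least : ∀ ℓ j → j < μ ℓ → Lam lam j ≤ ℓ
  μ-least ℓ zero    _    = z≤n
  μ-least ℓ (suc j) j<μ = proj₁ (proj₂ (muSearch-spec lam ℓ k 1)) (suc j) (s≤s z≤n) j<μ

  μ≤k : ∀ {ℓ} → ℓ < Λ → μ ℓ ≤ k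
  μ≤k {ℓ} ℓ<Λ = ≮⇒≥ (λ k<μ → <⇒≱ ℓ<Λ (μ-least ℓ k k<μ))

  <Lam-μ : ∀ {ℓ} → ℓ < Λ → ℓ < Lam lam (μ ℓ)
  <Lam-μ {ℓ} ℓ<Λ with proj₂ (proj₂ (muSearch-spec lam ℓ k 1))
  ... | inj₁ ℓ<Λμ = ℓ<Λμ
  ... | inj₂ μ≡1+k = ⊥-elim (<⇒≱ (s≤s ≤-refl) (subst (_≤ k) μ≡1+k (μ≤k ℓ<Λ)))

  μ-zero : μ 0 ≡ 1
  μ-zero = ≤-antisym (≮⇒≥ (λ 1<μ₀ → <⇒≱ 1≤λ₁ (μ-least 0 1 1<μ₀))) (μ-positive 0)

  hasBlockLength : ℕ → ℕ → Bool
  hasBlockLength j ℓ = (ℓ <ᵇ Λ) ∧ (μ ℓ ≡ᵇ j)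

  hasBlockLength-interval : ∀ {j} ℓ → 1 ≤ j → j ≤ k →
    hasBlockLength j ℓ ≡ (ℓ <ᵇ Lam lam j) ∧ not (ℓ <ᵇ Lam lam (j ∸ 1))
  hasBlockLength-interval {suc j} ℓ _ j<k with ℓ <? Λ
  ... | no ℓ≮Λ rewrite <ᵇ-false (≮⇒≥ ℓ≮Λ) | <ᵇ-false (≤-trans (Lam-mono lam j<k) (≮⇒≥ ℓ≮Λ)) = refl
  ... | yes ℓ<Λ rewrite <ᵇ-true ℓ<Λ with <-cmp (μ ℓ) (suc j)
  ...   | tri≈ _ μ≡1+j _ rewrite μ≡1+j | ≡ᵇ-refl j
          | <ᵇ-true (subst (λ m → ℓ < Lam lam m) μ≡1+j (<Lam-μ ℓ<Λ))
          | <ᵇ-false (μ-least ℓ j (subst (j <_) (sym μ≡1+j) ≤-refl)) = refl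
  ...   | tri> _ μ≢1+j 1+j<μ rewrite ≡ᵇ-false μ≢1+j | <ᵇ-false (μ-least ℓ (suc j) 1+j<μ) = refl
  ...   | tri< μ<1+j μ≢1+j _ rewrite ≡ᵇ-false μ≢1+j | <ᵇ-true (<-≤-trans (<Lam-μ ℓ<Λ) (Lam-mono lam (≤-pred μ<1+j)))
          = sym (∧-zeroʳ (ℓ <ᵇ Lam lam (suc j)))

  count-hasBlockLength : ∀ {j} → 1 ≤ j → j ≤ k → count (hasBlockLength j) (upTo Λ) ≡ lam j
  count-hasBlockLength {suc j} 1≤j j<k = begin
      count (hasBlockLength (suc j)) (upTo Λ)
    ≡⟨ count-cong (All.universal (λ ℓ → hasBlockLength-interval ℓ 1≤j j<k) (upTo Λ)) ⟩
      count (λ ℓ → (ℓ <ᵇ Lam lam (suc j)) ∧ not (ℓ <ᵇ Lam lam j)) (upTo Λ)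
    ≡⟨ count-interval-upTo (Lam-mono lam (n≤1+n j)) (Lam-mono lam j<k) ⟩
      Lam lam (suc j) ∸ Lam lam j
    ≡⟨ m+n∸m≡n (Lam lam j) (lam (suc j)) ⟩
      lam (suc j) ∎

  zerosAbove : ℕ → List ℕ → Bool
  zerosAbove ℓ r = allBelow (μ ℓ ∸ 1) (λ i → digitAt r i ≡ᵇ 0)

  -- The conditions of valid other than d_M ≠ 0, on the digit list read from d_0 upwards.
  admissible : List ℕ → Bool
  admissible []              = true
  admissible (ℓ ∷ [])        = ℓ <ᵇ Λ
  admissible (ℓ ∷ r@(_ ∷ _)) = (ℓ <ᵇ Λ) ∧ (zerosAbove ℓ r ∧ admissible r)

  admissible-spec : ∀ r →
    allBelow (length r) (λ i → digitAt r i <ᵇ Λ)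
    ∧ allBelow (length r ∸ 1) (λ i → allBelow (μ (digitAt r i) ∸ 1) (λ j → digitAt r (i + suc j) ≡ᵇ 0))
    ≡ admissible r
  admissible-spec []          = refl
  admissible-spec (ℓ ∷ [])    = ∧-identityʳ (ℓ <ᵇ Λ)
  admissible-spec (ℓ ∷ r@(_ ∷ r′)) = begin
      allBelow (suc (length r)) (λ i → digitAt (ℓ ∷ r) i <ᵇ Λ)
      ∧ allBelow (suc (length r′)) (λ i → allBelow (μ (digitAt (ℓ ∷ r) i) ∸ 1) (λ j → digitAt (ℓ ∷ r) (i + suc j) ≡ᵇ 0))
    ≡⟨ cong₂ _∧_ (allBelow-suc (length r) _) (allBelow-suc (length r′) _) ⟩
      ((ℓ <ᵇ Λ) ∧ bounded) ∧ (zerosAbove ℓ r ∧ blocks)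
    ≡⟨ shuffle (ℓ <ᵇ Λ) bounded (zerosAbove ℓ r) blocks ⟩
      (ℓ <ᵇ Λ) ∧ (zerosAbove ℓ r ∧ (bounded ∧ blocks))
    ≡⟨ cong (λ b → (ℓ <ᵇ Λ) ∧ (zerosAbove ℓ r ∧ b)) (admissible-spec r) ⟩
      admissible (ℓ ∷ r) ∎
    where
    bounded = allBelow (length r) (λ i → digitAt r i <ᵇ Λ)
    blocks = allBelow (length r ∸ 1) (λ i → allBelow (μ (digitAt r i) ∸ 1) (λ j → digitAt r (i + suc j) ≡ᵇ 0))
    shuffle : ∀ a b c d → (a ∧ b) ∧ (c ∧ d) ≡ a ∧ (c ∧ (b ∧ d))
    shuffle true  b true  d = refl
    shuffle true  b false d = ∧-zeroʳ b
    shuffle false b c     d = refl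

  valid≡admissible : ∀ d ds → valid lam k (d ∷ ds) ≡ not (d ≡ᵇ 0) ∧ admissible (reverse (d ∷ ds))
  valid≡admissible d ds = cong (not (d ≡ᵇ 0) ∧_)
    (trans (cong (λ n → allBelow n (λ i → digitAt r i <ᵇ Λ)
                        ∧ allBelow (n ∸ 1) (λ i → allBelow (μ (digitAt r i) ∸ 1) (λ j → digitAt r (i + suc j) ≡ᵇ 0)))
                 (sym (length-reverse (d ∷ ds))))
           (admissible-spec r))
    where
    r = reverse (d ∷ ds)

  admissible-zeros : ∀ n r → admissible (replicate n 0 ++ r) ≡ admissible r
  admissible-zeros zero    r = refl
  admissible-zeros (suc n) r = trans (admissible-zero (replicate n 0 ++ r)) (admissible-zeros n r)
    where
    admissible-zero : ∀ r → admissible (0 ∷ r) ≡ admissible r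
    admissible-zero []      = <ᵇ-true 1≤Λ
    admissible-zero (_ ∷ _) rewrite <ᵇ-true 1≤Λ | μ-zero = refl

  valid-++-zeros : ∀ ds n → valid lam k ds ≡ true → valid lam k (ds ++ replicate n 0) ≡ true
  valid-++-zeros (d ∷ ds) n valid-ds = begin
      valid lam k (d ∷ ds ++ replicate n 0)
    ≡⟨ valid≡admissible d (ds ++ replicate n 0) ⟩
      not (d ≡ᵇ 0) ∧ admissible (reverse (d ∷ ds ++ replicate n 0))
    ≡⟨ cong (λ r → not (d ≡ᵇ 0) ∧ admissible r)
            (trans (reverse-++ (d ∷ ds) (replicate n 0)) (cong (_++ reverse (d ∷ ds)) (reverse-replicate n 0))) ⟩
      not (d ≡ᵇ 0) ∧ admissible (replicate n 0 ++ reverse (d ∷ ds))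
    ≡⟨ cong (not (d ≡ᵇ 0) ∧_) (admissible-zeros n (reverse (d ∷ ds))) ⟩
      not (d ≡ᵇ 0) ∧ admissible (reverse (d ∷ ds))
    ≡⟨ sym (valid≡admissible d ds) ⟩
      valid lam k (d ∷ ds)
    ≡⟨ valid-ds ⟩
      true ∎

  finalBlockLength : List ℕ → ℕ
  finalBlockLength t = μ (digit t 0)

  module _ (d : ℕ) (ds : List ℕ) (valid-t : valid lam k (d ∷ ds) ≡ true) where
    private
      t = d ∷ ds
      bounded = allBelow (length t) (λ i → digit t i <ᵇ Λ)
      blocks  = allBelow (length t ∸ 1) (λ i → allBelow (μ (digit t i) ∸ 1) (λ j → digit t (i + suc j) ≡ᵇ 0))
      parts = ∧-true⁻¹ bounded blocks (proj₂ (∧-true⁻¹ (not (d ≡ᵇ 0)) _ valid-t))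

    valid⇒leading≢0 : d ≢ 0
    valid⇒leading≢0 d≡0 = false≢true (subst (λ x → not (x ≡ᵇ 0) ≡ true) d≡0 (proj₁ (∧-true⁻¹ (not (d ≡ᵇ 0)) _ valid-t)))

    valid⇒digit<Λ : ∀ i → i < length t → digit t i < Λ
    valid⇒digit<Λ i i<L = <ᵇ-true⁻¹ (allBelow-true (proj₁ parts) i i<L)

    valid⇒zerosAbove : ∀ i → i < length t ∸ 1 → ∀ j → j < μ (digit t i) ∸ 1 → digit t (i + suc j) ≡ 0
    valid⇒zerosAbove i i<L j j<μ = ≡ᵇ-true⁻¹ (allBelow-true (allBelow-true (proj₂ parts) i i<L) j j<μ)

  valid⇒finalBlockLength≤k : ∀ t → valid lam k t ≡ true → finalBlockLength t ≤ k
  valid⇒finalBlockLength≤k (d ∷ ds) valid-t = μ≤k (valid⇒digit<Λ d ds valid-t 0 (s≤s z≤n))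

  valid⇒finalBlockLength< : ∀ t → valid lam k t ≡ true → 2 ≤ length t → finalBlockLength t < length t
  valid⇒finalBlockLength< (d ∷ [])     _       (s≤s ())
  valid⇒finalBlockLength< (d ∷ e ∷ ds) valid-t _ = ≰⇒> (λ L≤μ → valid⇒leading≢0 d (e ∷ ds) valid-t (begin
      d                                  ≡⟨ digit-last d (e ∷ ds) ⟨
      digit (d ∷ e ∷ ds) (1 + length ds) ≡⟨ valid⇒zerosAbove d (e ∷ ds) valid-t 0 (s≤s z≤n) (length ds) (∸-monoˡ-≤ 1 L≤μ) ⟩
      0 ∎))

  isBlockʳ : ℕ → List ℕ → Bool
  isBlockʳ j []      = false
  isBlockʳ j (ℓ ∷ w) = hasBlockLength j ℓ ∧ allZero w

  isBlock : ℕ → List ℕ → Bool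
  isBlock j u = isBlockʳ j (reverse u)

  count-isBlock : ∀ {j} → 1 ≤ j → j ≤ k → count (isBlock j) (allLists Λ j) ≡ lam j
  count-isBlock {suc j} 1≤j j≤k = begin
      count (isBlock (suc j)) (allLists Λ (suc j))
    ≡⟨ cong (λ m → count (isBlock (suc j)) (allLists Λ m)) (+-comm 1 j) ⟩
      count (isBlock (suc j)) (allLists Λ (j + 1))
    ≡⟨ count-allLists-++ Λ j 1 split ⟩
      count allZero (allLists Λ j) * count (isBlockʳ (suc j)) (allLists Λ 1)
    ≡⟨ cong₂ _*_ (count-allZero-allLists 1≤Λ j) (count-allLists-one Λ (isBlockʳ (suc j))) ⟩
      1 * count (λ ℓ → hasBlockLength (suc j) ℓ ∧ true) (upTo Λ)
    ≡⟨ trans (*-identityˡ _) (count-cong (All.universal (λ ℓ → ∧-identityʳ (hasBlockLength (suc j) ℓ)) (upTo Λ))) ⟩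
      count (hasBlockLength (suc j)) (upTo Λ)
    ≡⟨ count-hasBlockLength 1≤j j≤k ⟩
      lam (suc j) ∎
    where
    split : ∀ w u → length w ≡ j → length u ≡ 1 → isBlock (suc j) (w ++ u) ≡ allZero w ∧ isBlockʳ (suc j) u
    split w (ℓ ∷ []) _ _ = begin
        isBlockʳ (suc j) (reverse (w ++ ℓ ∷ []))
      ≡⟨ cong (isBlockʳ (suc j)) (reverse-++ w (ℓ ∷ [])) ⟩
        hasBlockLength (suc j) ℓ ∧ allZero (reverse w)
      ≡⟨ cong (hasBlockLength (suc j) ℓ ∧_) (allZero-reverse w) ⟩
        hasBlockLength (suc j) ℓ ∧ allZero w
      ≡⟨ ∧-comm (hasBlockLength (suc j) ℓ) (allZero w) ⟩
        allZero w ∧ hasBlockLength (suc j) ℓ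
      ≡⟨ cong (allZero w ∧_) (sym (∧-identityʳ (hasBlockLength (suc j) ℓ))) ⟩
        allZero w ∧ isBlockʳ (suc j) (ℓ ∷ []) ∎

  admissible-block : ∀ ℓ w r → 1 ≤ length r →
    admissible (ℓ ∷ w ++ r) ∧ (μ ℓ ≡ᵇ suc (length w)) ≡ admissible r ∧ isBlockʳ (suc (length w)) (ℓ ∷ w)
  admissible-block ℓ w r 1≤r =
    trans (cong (_∧ (μ ℓ ≡ᵇ suc (length w))) (admissible-cons (w ++ r) 1≤w++r))
          (shuffle (ℓ <ᵇ Λ) (μ ℓ ≡ᵇ suc (length w)) (allZero w) zeros-above zeros-below)
    where
    admissible-cons : ∀ v → 1 ≤ length v → admissible (ℓ ∷ v) ≡ (ℓ <ᵇ Λ) ∧ (zerosAbove ℓ v ∧ admissible v)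
    admissible-cons (_ ∷ _) _ = refl
    1≤w++r : 1 ≤ length (w ++ r)
    1≤w++r = subst (1 ≤_) (sym (length-++ w)) (≤-trans 1≤r (m≤n+m (length r) (length w)))
    zeros-above : (μ ℓ ≡ᵇ suc (length w)) ≡ true → zerosAbove ℓ (w ++ r) ≡ allZero w
    zeros-above μ≡ = trans (cong (λ n → allBelow (n ∸ 1) (λ i → digitAt (w ++ r) i ≡ᵇ 0)) (≡ᵇ-true⁻¹ {μ ℓ} μ≡)) (allZero-prefix w r)
    zeros-below : allZero w ≡ true → admissible (w ++ r) ≡ admissible r
    zeros-below w≡0 = trans (cong (λ v → admissible (v ++ r)) (allZero⇒replicate w w≡0)) (admissible-zeros (length w) r)
    shuffle : ∀ a m z {x y g} → (m ≡ true → x ≡ z) → (z ≡ true → y ≡ g) → (a ∧ (x ∧ y)) ∧ m ≡ g ∧ ((a ∧ m) ∧ z)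
    shuffle a     false z     {x} {y} {g} _ _ rewrite ∧-zeroʳ (a ∧ (x ∧ y)) | ∧-zeroʳ a = sym (∧-zeroʳ g)
    shuffle true  true  true  x≡z y≡g rewrite x≡z refl | y≡g refl = refl
    shuffle false true  true  _   _   = sym (∧-zeroʳ _)
    shuffle true  true  false x≡z _   rewrite x≡z refl = sym (∧-zeroʳ _)
    shuffle false true  false _   _   = sym (∧-zeroʳ _)

  valid-++-block : ∀ {j} t u → 1 ≤ length t → 1 ≤ j → length u ≡ j →
    valid lam k (t ++ u) ∧ (finalBlockLength (t ++ u) ≡ᵇ j) ≡ valid lam k t ∧ isBlock j u
  valid-++-block {j} (d ∷ t) u _ 1≤j lu with reverse u in eu
  ... | []    = ⊥-elim (<⇒≱ 1≤j (≤-reflexive (trans (sym lu) (trans (sym (length-reverse u)) (cong length eu)))))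
  ... | ℓ ∷ w = begin
      valid lam k (d ∷ t ++ u) ∧ (μ (digitAt R 0) ≡ᵇ j)
    ≡⟨ cong (_∧ (μ (digitAt R 0) ≡ᵇ j)) (valid≡admissible d (t ++ u)) ⟩
      (nd ∧ admissible R) ∧ (μ (digitAt R 0) ≡ᵇ j)
    ≡⟨ cong (λ v → (nd ∧ admissible v) ∧ (μ (digitAt v 0) ≡ᵇ j)) R≡ ⟩
      (nd ∧ admissible (ℓ ∷ w ++ rt)) ∧ (μ ℓ ≡ᵇ j)
    ≡⟨ ∧-assoc nd _ _ ⟩
      nd ∧ (admissible (ℓ ∷ w ++ rt) ∧ (μ ℓ ≡ᵇ j))
    ≡⟨ cong (nd ∧_) (subst (λ j → admissible (ℓ ∷ w ++ rt) ∧ (μ ℓ ≡ᵇ j) ≡ admissible rt ∧ isBlockʳ j (ℓ ∷ w))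
                           j≡ (admissible-block ℓ w rt (subst (1 ≤_) (sym (length-reverse (d ∷ t))) (s≤s z≤n)))) ⟩
      nd ∧ (admissible rt ∧ isBlockʳ j (ℓ ∷ w))
    ≡⟨ sym (∧-assoc nd _ _) ⟩
      (nd ∧ admissible rt) ∧ isBlockʳ j (ℓ ∷ w)
    ≡⟨ cong (_∧ isBlockʳ j (ℓ ∷ w)) (sym (valid≡admissible d t)) ⟩
      valid lam k (d ∷ t) ∧ isBlockʳ j (ℓ ∷ w) ∎
    where
    nd = not (d ≡ᵇ 0)
    R  = reverse (d ∷ t ++ u)
    rt = reverse (d ∷ t)
    R≡ : R ≡ ℓ ∷ w ++ rt
    R≡ = trans (reverse-++ (d ∷ t) u) (cong (_++ rt) eu)
    j≡ : suc (length w) ≡ j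
    j≡ = trans (cong length (sym eu)) (trans (length-reverse u) lu)

-- The order on digit sequences

+-<ᵇ-cancelʳ : ∀ a b c → (a + c <ᵇ b + c) ≡ (a <ᵇ b)
+-<ᵇ-cancelʳ a b c = trans (cong₂ _<ᵇ_ (+-comm a c) (+-comm b c)) (cancelˡ c)
  where
  cancelˡ : ∀ c → (c + a <ᵇ c + b) ≡ (a <ᵇ b)
  cancelˡ zero    = refl
  cancelˡ (suc c) = cancelˡ c

+-≡ᵇ-cancelʳ : ∀ a b c → (a + c ≡ᵇ b + c) ≡ (a ≡ᵇ b)
+-≡ᵇ-cancelʳ a b c = trans (cong₂ _≡ᵇ_ (+-comm a c) (+-comm b c)) (cancelˡ c)
  where
  cancelˡ : ∀ c → (c + a ≡ᵇ c + b) ≡ (a ≡ᵇ b)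
  cancelˡ zero    = refl
  cancelˡ (suc c) = cancelˡ c

lexLess-replicate-zero : ∀ t → lexLess t (replicate (length t) 0) ≡ false
lexLess-replicate-zero []      = refl
lexLess-replicate-zero (x ∷ t) rewrite lexLess-replicate-zero t = ∧-zeroʳ (x ≡ᵇ 0)

lexLess-++-zeros : ∀ t s u → length t ≡ length s → lexLess (t ++ u) (s ++ replicate (length u) 0) ≡ lexLess t s
lexLess-++-zeros []      []      u _   = lexLess-replicate-zero u
lexLess-++-zeros (x ∷ t) (y ∷ s) u |t|≡|s| rewrite lexLess-++-zeros t s u (suc-injective |t|≡|s|) = refl

seqLess-++-zeros : ∀ t s u → seqLess (t ++ u) (s ++ replicate (length u) 0) ≡ seqLess t s
seqLess-++-zeros t s u
  rewrite length-++ t {u} | length-++ s {replicate (length u) 0} | length-replicate (length u) {0}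
        | +-<ᵇ-cancelʳ (length t) (length s) (length u) | +-≡ᵇ-cancelʳ (length t) (length s) (length u)
  with length t ≡ᵇ length s in |t|≡|s|
... | true  rewrite lexLess-++-zeros t s u (≡ᵇ-true⁻¹ |t|≡|s|) = refl
... | false = refl

-- Counting the predecessors

module Counting (lam : ℕ → ℕ) (k : ℕ) (1≤k : 1 ≤ k) (1≤λ₁ : 1 ≤ lam 1) (d : ℕ) (ds : List ℕ) where
  open Numeration lam k 1≤k 1≤λ₁

  padded : ℕ → List ℕ
  padded n = d ∷ ds ++ replicate n 0

  below : ℕ → List ℕ → Bool
  below n t = valid lam k t ∧ seqLess t (padded n)

  belowEnding : ℕ → ℕ → List ℕ → Bool
  belowEnding n j t = below n t ∧ (finalBlockLength t ≡ᵇ j)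

  predecessors : ℕ → ℕ
  predecessors n = countBefore lam k (padded n)

  predecessors-by-length : ∀ n → predecessors n ≡ sum1 (length (padded n)) (λ m → count (below n) (allLists Λ m))
  predecessors-by-length n = trans (length-filter≡count (below n) (allListsUpTo Λ (length (padded n)))) (count-allListsUpTo Λ (length (padded n)) (below n))

  padded-split : ∀ {n j} → j ≤ n → padded n ≡ padded (n ∸ j) ++ replicate j 0
  padded-split {n} {j} j≤n = begin
      d ∷ ds ++ replicate n 0
    ≡⟨ cong (λ m → d ∷ ds ++ replicate m 0) (sym (m∸n+n≡m j≤n)) ⟩
      d ∷ ds ++ replicate (n ∸ j + j) 0
    ≡⟨ cong (λ r → d ∷ ds ++ r) (replicate-+ (n ∸ j) j 0) ⟩
      d ∷ ds ++ replicate (n ∸ j) 0 ++ replicate j 0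
    ≡⟨ cong (d ∷_) (sym (++-assoc ds (replicate (n ∸ j) 0) (replicate j 0))) ⟩
      padded (n ∸ j) ++ replicate j 0 ∎

  count-below-by-finalBlock : ∀ n xs → count (below n) xs ≡ sum1 k (λ j → count (belowEnding n j) xs)
  count-below-by-finalBlock n = count-sum1 k split
    where
    split : ∀ t → indicator (below n t) ≡ sum1 k (λ j → indicator (belowEnding n j t))
    split t with below n t in below-t
    ... | false = sym (trans (sum1-cong k (λ _ _ _ → refl)) (sum1-zeros k))
    ... | true  = sym (sum1-indicator-≡ᵇ k (μ-positive (digit t 0)) (valid⇒finalBlockLength≤k t valid-t))
      where
      valid-t = proj₁ (∧-true⁻¹ (valid lam k t) _ below-t)

  count-belowEnding-long : ∀ {n j} m → 1 ≤ j → j ≤ k → j ≤ n → 1 ≤ m →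
    count (belowEnding n j) (allLists Λ (j + m)) ≡ lam j * count (below (n ∸ j)) (allLists Λ m)
  count-belowEnding-long {n} {j} m 1≤j j≤k j≤n 1≤m = begin
      count (belowEnding n j) (allLists Λ (j + m))
    ≡⟨ cong (λ l → count (belowEnding n j) (allLists Λ l)) (+-comm j m) ⟩
      count (belowEnding n j) (allLists Λ (m + j))
    ≡⟨ count-allLists-++ Λ m j split ⟩
      count (below (n ∸ j)) (allLists Λ m) * count (isBlock j) (allLists Λ j)
    ≡⟨ cong (count (below (n ∸ j)) (allLists Λ m) *_) (count-isBlock 1≤j j≤k) ⟩
      count (below (n ∸ j)) (allLists Λ m) * lam j
    ≡⟨ *-comm _ (lam j) ⟩
      lam j * count (below (n ∸ j)) (allLists Λ m) ∎
    where
    ∧-swapʳ : ∀ a b c → (a ∧ b) ∧ c ≡ (a ∧ c) ∧ b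
    ∧-swapʳ true  b c = ∧-comm b c
    ∧-swapʳ false b c = refl
    split : ∀ t u → length t ≡ m → length u ≡ j → belowEnding n j (t ++ u) ≡ below (n ∸ j) t ∧ isBlock j u
    split t u |t|≡m |u|≡j = begin
        (valid lam k (t ++ u) ∧ seqLess (t ++ u) (padded n)) ∧ (finalBlockLength (t ++ u) ≡ᵇ j)
      ≡⟨ ∧-swapʳ (valid lam k (t ++ u)) _ _ ⟩
        (valid lam k (t ++ u) ∧ (finalBlockLength (t ++ u) ≡ᵇ j)) ∧ seqLess (t ++ u) (padded n)
      ≡⟨ cong₂ _∧_ (valid-++-block t u (subst (1 ≤_) (sym |t|≡m) 1≤m) 1≤j |u|≡j) order ⟩
        (valid lam k t ∧ isBlock j u) ∧ seqLess t (padded (n ∸ j))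
      ≡⟨ ∧-swapʳ (valid lam k t) _ _ ⟩
        below (n ∸ j) t ∧ isBlock j u ∎
      where
      order : seqLess (t ++ u) (padded n) ≡ seqLess t (padded (n ∸ j))
      order = trans (cong (seqLess (t ++ u)) (trans (padded-split j≤n) (cong (λ l → padded (n ∸ j) ++ replicate l 0) (sym |u|≡j))))
                    (seqLess-++-zeros t (padded (n ∸ j)) u)

  count-belowEnding-short : ∀ {n j m} → 2 ≤ m → m ≤ j → count (belowEnding n j) (allLists Λ m) ≡ 0
  count-belowEnding-short {n} {j} {m} 2≤m m≤j =
    trans (count-cong (All.map (λ {t} → vanish t) (allLists-length Λ m))) (count-false (allLists Λ m))
    where
    vanish : ∀ t → length t ≡ m → belowEnding n j t ≡ false
    vanish t |t|≡m with below n t in below-t | finalBlockLength t ≡ᵇ j in final≡j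
    ... | false | _     = refl
    ... | true  | false = refl
    ... | true  | true  = ⊥-elim (<⇒≱ (valid⇒finalBlockLength< t valid-t (subst (2 ≤_) (sym |t|≡m) 2≤m))
                                      (subst₂ _≤_ (sym |t|≡m) (sym (≡ᵇ-true⁻¹ {finalBlockLength t} final≡j)) m≤j))
      where
      valid-t = proj₁ (∧-true⁻¹ (valid lam k t) _ below-t)

  predecessors-ending : ∀ {n j} → 1 ≤ j → j ≤ k → j ≤ n →
    sum1 (length (padded n)) (λ m → count (belowEnding n j) (allLists Λ m))
    ≡ count (belowEnding n j) (allLists Λ 1) + lam j * predecessors (n ∸ j)
  predecessors-ending {n} {j} 1≤j j≤k j≤n = begin
      sum1 (length (padded n)) f
    ≡⟨ cong (λ l → sum1 l f) |padded| ⟩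
      sum1 (j + L) f
    ≡⟨ sum1-+-split j L f ⟩
      sum1 j f + sum1 L (λ m → f (j + m))
    ≡⟨ cong₂ _+_ (sum1-first j f 1≤j (λ m 2≤m m≤j → count-belowEnding-short 2≤m m≤j))
                 (sum1-cong L (λ m 1≤m _ → count-belowEnding-long m 1≤j j≤k j≤n 1≤m)) ⟩
      f 1 + sum1 L (λ m → lam j * count (below (n ∸ j)) (allLists Λ m))
    ≡⟨ cong (f 1 +_) (sum1-*ˡ L (lam j) _) ⟩
      f 1 + lam j * sum1 L (λ m → count (below (n ∸ j)) (allLists Λ m))
    ≡⟨ cong (λ c → f 1 + lam j * c) (sym (predecessors-by-length (n ∸ j))) ⟩
      f 1 + lam j * predecessors (n ∸ j) ∎
    where
    f : ℕ → ℕ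
    f m = count (belowEnding n j) (allLists Λ m)
    L : ℕ
    L = length (padded (n ∸ j))
    |padded| : length (padded n) ≡ j + L
    |padded| = begin
      length (padded n)                          ≡⟨ cong length (padded-split j≤n) ⟩
      length (padded (n ∸ j) ++ replicate j 0)   ≡⟨ length-++ (padded (n ∸ j)) ⟩
      L + length (replicate j 0)                 ≡⟨ cong (L +_) (length-replicate j) ⟩
      L + j                                      ≡⟨ +-comm L j ⟩
      j + L ∎

  count-below-oneDigit : ∀ {n} → 1 ≤ n → suc (count (below n) (allLists Λ 1)) ≡ Λ
  count-below-oneDigit {n} 1≤n = begin
      suc (count (below n) (allLists Λ 1))
    ≡⟨ cong suc (count-allLists-one Λ (below n)) ⟩
      suc (count (λ x → below n (x ∷ [])) (upTo Λ))
    ≡⟨ cong suc (count-cong (All.universal singleton (upTo Λ))) ⟩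
      suc (count (λ x → (x <ᵇ Λ) ∧ not (x <ᵇ 1)) (upTo Λ))
    ≡⟨ cong suc (count-interval-upTo 1≤Λ ≤-refl) ⟩
      suc (Λ ∸ 1)
    ≡⟨ m+[n∸m]≡n 1≤Λ ⟩
      Λ ∎
    where
    shorter : 1 < length (padded n)
    shorter = s≤s (subst (1 ≤_) (sym (trans (length-++ ds) (cong (length ds +_) (length-replicate n))))
                         (≤-trans 1≤n (m≤n+m n (length ds))))
    singleton : ∀ x → below n (x ∷ []) ≡ (x <ᵇ Λ) ∧ not (x <ᵇ 1)
    singleton x rewrite <ᵇ-true shorter with x
    ... | zero  = sym (∧-zeroʳ _)
    ... | suc x rewrite ∧-identityʳ (suc x <ᵇ Λ) = ∧-identityʳ (suc x <ᵇ Λ)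

  predecessors-recurrence : ∀ {n} → k ≤ n → suc (predecessors n) ≡ Λ + sum1 k (λ j → lam j * predecessors (n ∸ j))
  predecessors-recurrence {n} k≤n = begin
      suc (predecessors n)
    ≡⟨ cong suc (predecessors-by-length n) ⟩
      suc (sum1 L (λ m → count (below n) (allLists Λ m)))
    ≡⟨ cong suc (sum1-cong L (λ m _ _ → count-below-by-finalBlock n (allLists Λ m))) ⟩
      suc (sum1 L (λ m → sum1 k (λ j → count (belowEnding n j) (allLists Λ m))))
    ≡⟨ cong suc (sum1-comm L k (λ m j → count (belowEnding n j) (allLists Λ m))) ⟩
      suc (sum1 k (λ j → sum1 L (λ m → count (belowEnding n j) (allLists Λ m))))
    ≡⟨ cong suc (sum1-cong k (λ j 1≤j j≤k → predecessors-ending 1≤j j≤k (≤-trans j≤k k≤n))) ⟩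
      suc (sum1 k (λ j → count (belowEnding n j) (allLists Λ 1) + lam j * predecessors (n ∸ j)))
    ≡⟨ cong suc (sum1-+ k _ _) ⟩
      suc (sum1 k (λ j → count (belowEnding n j) (allLists Λ 1)) + rest)
    ≡⟨ cong (λ c → suc (c + rest)) (sym (count-below-by-finalBlock n (allLists Λ 1))) ⟩
      suc (count (below n) (allLists Λ 1)) + rest
    ≡⟨ cong (_+ rest) (count-below-oneDigit (≤-trans 1≤k k≤n)) ⟩
      Λ + rest ∎
    where
    L : ℕ
    L = length (padded n)
    rest : ℕ
    rest = sum1 k (λ j → lam j * predecessors (n ∸ j))

-- Only k ≥ 1 and λ₁ ≥ 1 enter the count.
proposition4p17 : (k : ℕ) (lam : ℕ → ℕ) → 1 ≤ k → 1 ≤ lam 1 → 1 ≤ lam k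
    → (∀ i → k < i → lam i ≡ 0) → (k ≡ 1 → 2 ≤ lam 1)
    → (ds : List ℕ) → valid lam k ds ≡ true
    → (∀ n → ∃ λ N → IsZeck lam k N (ds ++ replicate n 0))
      × ((b : ℕ → ℕ) → (∀ n → IsZeck lam k (b n) (ds ++ replicate n 0))
         → ∀ n → k ≤ n → b n ≡ sum1 k (λ i → lam i * b (n ∸ i)))
proposition4p17 k lam 1≤k 1≤λ₁ _ _ _ []       ()
proposition4p17 k lam 1≤k 1≤λ₁ _ _ _ (d ∷ ds) valid-ds = representation , recurrence
  where
  open Numeration lam k 1≤k 1≤λ₁
  open Counting lam k 1≤k 1≤λ₁ d ds
  representation : ∀ n → ∃ λ N → IsZeck lam k N (padded n)
  representation n = suc (predecessors n) , valid-++-zeros (d ∷ ds) n valid-ds , refl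
  recurrence : (b : ℕ → ℕ) → (∀ n → IsZeck lam k (b n) (padded n)) → ∀ n → k ≤ n → b n ≡ sum1 k (λ i → lam i * b (n ∸ i))
  recurrence b b-zeck n k≤n = begin
      b n
    ≡⟨ proj₂ (b-zeck n) ⟩
      suc (predecessors n)
    ≡⟨ predecessors-recurrence k≤n ⟩
      sum1 k lam + sum1 k (λ i → lam i * predecessors (n ∸ i))
    ≡⟨ sum1-+ k lam _ ⟨
      sum1 k (λ i → lam i + lam i * predecessors (n ∸ i))
    ≡⟨ sum1-cong k (λ i _ _ → trans (cong (lam i *_) (proj₂ (b-zeck (n ∸ i)))) (*-suc (lam i) _)) ⟨
      sum1 k (λ i → lam i * b (n ∸ i)) ∎
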